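{- For an integer $n>1$, let $k=\lceil\log_2 n\rceil$ and define the graph $G^\star$ as follows. Its vertex set consists of $v^{(0)}_j$ for $j\in\{1,\dots,k\}$, $v^{(l)}_i$ for $l\in\{1,2,3\}$ and $i\in\{1,\dots,n-1\}$, and two further vertices $F$ and $E$. Its edges are: $F v^{(0)}_j$ for all $j$; $v^{(0)}_j v^{(1)}_i$ whenever the $j$-th bit of the $k$-bit binary representation of $i$ equals $1$ (bits indexed so that $j=k$ is the least significant bit); $v^{(l)}_i v^{(l+1)}_i$ for $l\in\{1,2\}$ and all $i$; and $v^{(3)}_i E$ for all $i$. Let $G^{\star\prime}$ be the graph obtained from $G^\star$ by adding the edge $EF$. Then $\beta(G^{\star\prime})\ge n-2$.
   Context: For a connected graph $G=(V,E)$, a set $R\subseteq V$ is resolving if for every pair of distinct vertices $A\neq B$ there is $X\in R$ with $d_G(A,X)\neq d_G(B,X)$, where $d_G$ is shortest-path distance. The metric dimension $\beta(G)$ is the minimum cardinality of a resolving set. -}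

module Defs where

open import Data.Nat using (ℕ; zero; suc; _≤_; _∸_; _%_; ⌊_/2⌋)
open import Data.Nat.Logarithm using (⌈log₂_⌉)
open import Data.Fin using (Fin; toℕ)
open import Data.List using (List)
open import Data.List.Membership.Propositional using (_∈_)
open import Data.Product using (Σ; _×_; ∃)
open import Data.Sum using (_⊎_)
open import Relation.Binary.PropositionalEquality using (_≡_; _≢_)

data Walk {V : Set} (Adj : V → V → Set) : V → V → ℕ → Set where
  here : ∀ {x} → Walk Adj x x 0
  step : ∀ {x y z m} → Adj x y → Walk Adj y z m → Walk Adj x z (suc m)

IsDist : {V : Set} → (V → V → Set) → V → V → ℕ → Set
IsDist Adj x y d = Walk Adj x y d × (∀ m → Walk Adj x y m → d ≤ m)

Resolving : {V : Set} → (V → V → Set) → List V → Set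
Resolving {V} Adj R =
  (A B : V) → A ≢ B →
  Σ V λ X → X ∈ R ×
    (∀ d₁ d₂ → IsDist Adj A X d₁ → IsDist Adj B X d₂ → d₁ ≢ d₂)

-- Vertices: v0 j (j ∈ {1..k}, stored 0-based as Fin k),
-- v1 i, v2 i, v3 i (i ∈ {1..n-1}, stored 0-based as Fin (n ∸ 1)),
-- and F, E.
data Vtx (n : ℕ) : Set where
  v0 : Fin ⌈log₂ n ⌉ → Vtx n
  v1 v2 v3 : Fin (n ∸ 1) → Vtx n
  F E : Vtx n

shr : ℕ → ℕ → ℕ
shr zero    i = i
shr (suc e) i = shr e ⌊ i /2⌋

-- The j-th bit (j = 1..k, j = k least significant) of the k-bit binary
-- representation of i equals (i / 2^(k-j)) mod 2.  Here j is 0-based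
-- (jf : Fin k represents j = toℕ jf + 1), so the shift is k ∸ suc (toℕ jf).
bit : (k : ℕ) → Fin k → ℕ → ℕ
bit k jf i = shr (k ∸ suc (toℕ jf)) i % 2

idx : ∀ {m} → Fin m → ℕ
idx i = suc (toℕ i)

-- Edges of G⋆ (each listed once, in one orientation)
data Edge⋆ (n : ℕ) : Vtx n → Vtx n → Set where
  F-v0  : ∀ j → Edge⋆ n F (v0 j)
  v0-v1 : ∀ j i → bit ⌈log₂ n ⌉ j (idx i) ≡ 1 → Edge⋆ n (v0 j) (v1 i)
  v1-v2 : ∀ i → Edge⋆ n (v1 i) (v2 i)
  v2-v3 : ∀ i → Edge⋆ n (v2 i) (v3 i)
  v3-E  : ∀ i → Edge⋆ n (v3 i) E

data Edge⋆′ (n : ℕ) : Vtx n → Vtx n → Set where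
  old : ∀ {x y} → Edge⋆ n x y → Edge⋆′ n x y
  E-F : Edge⋆′ n E F

Adj⋆′ : (n : ℕ) → Vtx n → Vtx n → Set
Adj⋆′ n x y = Edge⋆′ n x y ⊎ Edge⋆′ n y x

{-# OPTIONS --safe #-}
-- For distinct legs a ≠ b, every vertex X on neither leg is equally far from the leg ends
-- v3 a and v3 b (namely 1 + d(E, X)), so a resolving set meets leg a or leg b; hence it
-- meets all but at most one of the n − 1 legs. The distances are certified by potentials:
-- G⋆′ folds onto the 6-cycle (v0-layer, v1, v2, v3, E, F), and moving from one leg to
-- another costs 2 beyond the distance on that cycle, so the cycle distance to X plus this
-- leg-switch cost is 1-Lipschitz and bounds the length of every walk to X from below.
module Submission where

open import Defs
open import Data.Nat using (ℕ; zero; suc; _<_; _≤_; _∸_; _+_; _⊓_; ∣_-_∣; _≤?_; s≤s)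
open import Data.Nat.DivMod using (_mod_)
open import Data.Nat.Properties using (≤-refl; ≤-trans; +-identityʳ; +-monoˡ-≤; +-monoʳ-≤; m≤m+n; ∣n-n∣≡0)
open import Data.Fin using (Fin; toℕ; #_; punchIn; _≟_)
open import Data.Fin.Properties using (all?; any?; injective⇒≤; punchIn-injective; punchInᵢ≢i)
open import Data.Maybe using (Maybe; just; nothing)
open import Data.Maybe.Properties using (≡-dec; just-injective)
open import Data.List using (List; length; lookup)
open import Data.List.Membership.Propositional using (lose)
open import Data.List.Relation.Unary.Any as Any using (Any; index)
open import Data.List.Relation.Unary.Any.Properties using (lookup-index)
open import Data.List.Relation.Unary.Unique.Propositional using (Unique)
open import Data.Product using (_×_; _,_; proj₁; proj₂; ∃-syntax)
open import Data.Sum using (_⊎_; inj₁; inj₂; fromInj₁)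
open import Function using (_∘_; Injective)
open import Relation.Nullary using (Dec; yes; no; ¬?; contradiction)
open import Relation.Nullary.Decidable using (True; toWitness; decidable-stable; _×-dec_)
open import Relation.Unary using (Pred; Decidable)
open import Relation.Binary.PropositionalEquality
  using (_≡_; _≢_; refl; sym; trans; cong; subst; module ≡-Reasoning)

private
  variable
    n a b d : ℕ

≤-compute : {_ : True (a ≤? b)} → a ≤ b
≤-compute {_} {_} {a≤b} = toWitness a≤b

infix 4 _≈₁_ _≈₁?_

_≈₁_ : ℕ → ℕ → Set
a ≈₁ b = a ≤ suc b × b ≤ suc a

_≈₁?_ : ∀ a b → Dec (a ≈₁ b)
a ≈₁? b = (a ≤? suc b) ×-dec (b ≤? suc a)

≈₁-compute : {_ : True (a ≈₁? b)} → a ≈₁ b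
≈₁-compute {_} {_} {a≈₁b} = toWitness a≈₁b

≈₁-sym : a ≈₁ b → b ≈₁ a
≈₁-sym (a≤1+b , b≤1+a) = b≤1+a , a≤1+b

+-≈₁ : ∀ d → a ≈₁ b → a + d ≈₁ b + d
+-≈₁ d (a≤1+b , b≤1+a) = +-monoˡ-≤ d a≤1+b , +-monoˡ-≤ d b≤1+a

≈₁-+-≤2 : a ≤ suc b → b + 2 ≤ suc a → d ≤ 2 → a ≈₁ b + d
≈₁-+-≤2 {b = b} {d = d} a≤1+b b+2≤1+a d≤2 =
  ≤-trans a≤1+b (s≤s (m≤m+n b d)) , ≤-trans (+-monoʳ-≤ b d≤2) b+2≤1+a

module _ {V : Set} where

  Lipschitz : (V → V → Set) → (V → ℕ) → Set
  Lipschitz Adj f = ∀ {x y} → Adj x y → f x ≤ suc (f y)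

  Lipschitz-symmetric : {Edge : V → V → Set} {f : V → ℕ} →
    (∀ {x y} → Edge x y → f x ≈₁ f y) →
    Lipschitz (λ x y → Edge x y ⊎ Edge y x) f
  Lipschitz-symmetric f≈₁ (inj₁ e) = proj₁ (f≈₁ e)
  Lipschitz-symmetric f≈₁ (inj₂ e) = proj₂ (f≈₁ e)

  Lipschitz-walk : {Adj : V → V → Set} {f : V → ℕ} → Lipschitz Adj f →
    ∀ {x y m} → Walk Adj x y m → f x ≤ m + f y
  Lipschitz-walk f-lip here = ≤-refl
  Lipschitz-walk f-lip (step e w) = ≤-trans (f-lip e) (s≤s (Lipschitz-walk f-lip w))

  isDist-by-potential : {Adj : V → V → Set} {f : V → ℕ} → Lipschitz Adj f →
    ∀ {x y} → f y ≡ 0 → Walk Adj x y (f x) → IsDist Adj x y (f x)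
  isDist-by-potential f-lip fy≡0 w = w , λ m w′ →
    subst (_ ≤_) (trans (cong (m +_) fy≡0) (+-identityʳ m)) (Lipschitz-walk f-lip w′)

leg : Vtx n → Maybe (Fin (n ∸ 1))
leg (v1 i) = just i
leg (v2 i) = just i
leg (v3 i) = just i
leg _      = nothing

pos : Vtx n → Fin 6
pos (v0 _) = # 0
pos (v1 _) = # 1
pos (v2 _) = # 2
pos (v3 _) = # 3
pos E      = # 4
pos F      = # 5

cycleDist : Fin 6 → Fin 6 → ℕ
cycleDist p q = ∣ toℕ p - toℕ q ∣ ⊓ (6 ∸ ∣ toℕ p - toℕ q ∣)

next : Fin 6 → Fin 6
next p = suc (toℕ p) mod 6

cycleDist-next : ∀ p q → cycleDist p q ≈₁ cycleDist p (next q)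
cycleDist-next = toWitness {a? = all? λ p → all? λ q → cycleDist p q ≈₁? cycleDist p (next q)} _

-- Splitting on the second argument first makes legSwitch i nothing reduce for every i.
legSwitch : ∀ {m} → Maybe (Fin m) → Maybe (Fin m) → ℕ
legSwitch _        nothing  = 0
legSwitch nothing  (just _) = 0
legSwitch (just l) (just k) with l ≟ k
... | yes _ = 0
... | no _  = 2

legSwitch-refl : ∀ {m} (i : Maybe (Fin m)) → legSwitch i i ≡ 0
legSwitch-refl nothing = refl
legSwitch-refl (just l) with l ≟ l
... | yes _   = refl
... | no l≢l = contradiction refl l≢l

legSwitch-≢ : ∀ {m} {l k : Fin m} → l ≢ k → legSwitch (just l) (just k) ≡ 2
legSwitch-≢ {l = l} {k} l≢k with l ≟ k
... | yes l≡k = contradiction l≡k l≢k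
... | no _    = refl

legSwitch-≤2 : ∀ {m} (l k : Fin m) → legSwitch (just l) (just k) ≤ 2
legSwitch-≤2 l k with l ≟ k
... | yes _ = ≤-compute
... | no _  = ≤-compute

potential : Vtx n → Vtx n → ℕ
potential X Y = cycleDist (pos X) (pos Y) + legSwitch (leg X) (leg Y)

potential-self : (X : Vtx n) → potential X X ≡ 0
potential-self X rewrite ∣n-n∣≡0 (toℕ (pos X)) = legSwitch-refl (leg X)

-- Every edge moves pos one step forward around the cycle; legSwitch changes only when an
-- edge enters a leg from v0 or E.
potential-≈₁ : (X : Vtx n) → ∀ {x y} → Edge⋆′ n x y → potential X x ≈₁ potential X y
potential-≈₁ X (old (F-v0 _))   = +-≈₁ _ (cycleDist-next (pos X) _)
potential-≈₁ X (old (v1-v2 _))  = +-≈₁ _ (cycleDist-next (pos X) _)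
potential-≈₁ X (old (v2-v3 _))  = +-≈₁ _ (cycleDist-next (pos X) _)
potential-≈₁ X E-F              = +-≈₁ _ (cycleDist-next (pos X) _)
potential-≈₁ (v0 _) (old (v0-v1 _ _ _)) = ≈₁-compute
potential-≈₁ (v1 l) (old (v0-v1 _ k _)) = ≈₁-+-≤2 ≤-compute ≤-compute (legSwitch-≤2 l k)
potential-≈₁ (v2 l) (old (v0-v1 _ k _)) = ≈₁-+-≤2 ≤-compute ≤-compute (legSwitch-≤2 l k)
potential-≈₁ (v3 l) (old (v0-v1 _ k _)) = ≈₁-+-≤2 ≤-compute ≤-compute (legSwitch-≤2 l k)
potential-≈₁ F      (old (v0-v1 _ _ _)) = ≈₁-compute
potential-≈₁ E      (old (v0-v1 _ _ _)) = ≈₁-compute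
potential-≈₁ (v0 _) (old (v3-E _)) = ≈₁-compute
potential-≈₁ (v1 l) (old (v3-E k)) = ≈₁-sym (≈₁-+-≤2 ≤-compute ≤-compute (legSwitch-≤2 l k))
potential-≈₁ (v2 l) (old (v3-E k)) = ≈₁-sym (≈₁-+-≤2 ≤-compute ≤-compute (legSwitch-≤2 l k))
potential-≈₁ (v3 l) (old (v3-E k)) = ≈₁-sym (≈₁-+-≤2 ≤-compute ≤-compute (legSwitch-≤2 l k))
potential-≈₁ F      (old (v3-E _)) = ≈₁-compute
potential-≈₁ E      (old (v3-E _)) = ≈₁-compute

potential-Lipschitz : (X : Vtx n) → Lipschitz (Adj⋆′ n) (potential X)
potential-Lipschitz X = Lipschitz-symmetric (λ {x} {y} → potential-≈₁ X {x} {y})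

distFromE : Vtx n → ℕ
distFromE (v0 _) = 2
distFromE (v1 _) = 3
distFromE (v2 _) = 2
distFromE (v3 _) = 1
distFromE F      = 1
distFromE E      = 0

walk-from-E : (X : Vtx n) → Walk (Adj⋆′ n) E X (distFromE X)
walk-from-E (v0 j) = step (inj₁ E-F) (step (inj₁ (old (F-v0 j))) here)
walk-from-E (v1 l) =
  step (inj₂ (old (v3-E l))) (step (inj₂ (old (v2-v3 l))) (step (inj₂ (old (v1-v2 l))) here))
walk-from-E (v2 l) = step (inj₂ (old (v3-E l))) (step (inj₂ (old (v2-v3 l))) here)
walk-from-E (v3 l) = step (inj₂ (old (v3-E l))) here
walk-from-E F      = step (inj₁ E-F) here
walk-from-E E      = here

potential-at-leg-end : ∀ {a : Fin (n ∸ 1)} (X : Vtx n) → leg X ≢ just a →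
  potential X (v3 a) ≡ suc (distFromE X)
potential-at-leg-end (v0 _) _ = refl
potential-at-leg-end (v1 _) X∉a = cong (2 +_) (legSwitch-≢ (X∉a ∘ cong just))
potential-at-leg-end (v2 _) X∉a = cong (1 +_) (legSwitch-≢ (X∉a ∘ cong just))
potential-at-leg-end (v3 _) X∉a = legSwitch-≢ (X∉a ∘ cong just)
potential-at-leg-end F      _ = refl
potential-at-leg-end E      _ = refl

isDist-from-leg-end : ∀ {a : Fin (n ∸ 1)} (X : Vtx n) → leg X ≢ just a →
  IsDist (Adj⋆′ n) (v3 a) X (suc (distFromE X))
isDist-from-leg-end {a = a} X X∉a =
  subst (IsDist (Adj⋆′ _) (v3 a) X) at-leg-end
    (isDist-by-potential (potential-Lipschitz X) (potential-self X)
      (subst (Walk (Adj⋆′ _) (v3 a) X) (sym at-leg-end)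
        (step (inj₁ (old (v3-E a))) (walk-from-E X))))
  where
  at-leg-end : potential X (v3 a) ≡ suc (distFromE X)
  at-leg-end = potential-at-leg-end X X∉a

Covers : List (Vtx n) → Fin (n ∸ 1) → Set
Covers R a = Any (λ X → leg X ≡ just a) R

covers? : (R : List (Vtx n)) → Decidable (Covers R)
covers? R a = Any.any? (λ X → ≡-dec _≟_ (leg X) (just a)) R

resolving⇒covers : ∀ {R : List (Vtx n)} → Resolving (Adj⋆′ n) R →
  ∀ {a b} → a ≢ b → Covers R a ⊎ Covers R b
resolving⇒covers resolving {a} {b} a≢b
  with resolving (v3 a) (v3 b) (λ { refl → a≢b refl })
... | X , X∈R , separates with ≡-dec _≟_ (leg X) (just a) | ≡-dec _≟_ (leg X) (just b)
...   | yes X∈a | _       = inj₁ (lose X∈R X∈a)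
...   | no _    | yes X∈b = inj₂ (lose X∈R X∈b)
...   | no X∉a  | no X∉b  =
  contradiction refl (separates _ _ (isDist-from-leg-end X X∉a) (isDist-from-leg-end X X∉b))

all-but-one : ∀ {m p} {P : Pred (Fin (suc m)) p} → Decidable P →
  (∀ {i j} → i ≢ j → P i ⊎ P j) → ∃[ i₀ ] (∀ i → i ≢ i₀ → P i)
all-but-one P? P-pairs with any? (¬? ∘ P?)
... | yes (i₀ , ¬Pi₀) = i₀ , λ i i≢i₀ → fromInj₁ (λ Pi₀ → contradiction Pi₀ ¬Pi₀) (P-pairs i≢i₀)
... | no ∄¬P = # 0 , λ i _ → decidable-stable (P? i) (λ ¬Pi → ∄¬P (i , ¬Pi))

cover⇒≤-length : ∀ {A B : Set} (g : A → B) (xs : List A) {m} (h : Fin m → B) →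
  Injective _≡_ _≡_ h → (∀ k → Any (λ x → g x ≡ h k) xs) → m ≤ length xs
cover⇒≤-length g xs h h-injective cover = injective⇒≤ index-injective
  where
  open ≡-Reasoning
  index-injective : Injective _≡_ _≡_ (λ k → index (cover k))
  index-injective {k} {k′} same-index = h-injective (begin
    h k                               ≡⟨ sym (lookup-index (cover k)) ⟩
    g (lookup xs (index (cover k)))   ≡⟨ cong (g ∘ lookup xs) same-index ⟩
    g (lookup xs (index (cover k′)))  ≡⟨ lookup-index (cover k′) ⟩
    h k′                              ∎)

claim5 : (n : ℕ) → 1 < n → (R : List (Vtx n)) → Unique R →
    Resolving (Adj⋆′ n) R → n ∸ 2 ≤ length R
claim5 (suc zero) (s≤s ()) _ _ _
claim5 (suc (suc m)) _ R _ resolving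
  with all-but-one (covers? R) (resolving⇒covers resolving)
... | i₀ , covered =
  cover⇒≤-length leg R (just ∘ punchIn i₀) (punchIn-injective i₀ _ _ ∘ just-injective)
    (λ k → covered (punchIn i₀ k) (punchInᵢ≢i i₀ k))
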